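{- Let $\mathcal{Q},\mathcal{Q}',\mathcal{Q}''$ be sequences of propositional quantifiers, $p_1,p_2$ atomic propositions and $\Phi$ a QCTL formula, where every quantifier introduces a fresh atomic proposition. Then \[\mathcal{Q}\,\exists p_1\,\mathcal{Q}'\,\forall p_2\,\mathcal{Q}''.\Big(\mathrm{uniq}(p_1)\wedge\big(\mathrm{uniq}(p_2)\to\Phi\big)\Big)\;\equiv\;\mathcal{Q}\,\exists p_1\,\mathcal{Q}'\,\forall p_2\,\mathcal{Q}''.\Big(\mathrm{uniq}(p_2)\to\big(\mathrm{uniq}(p_1)\wedge\Phi\big)\Big).\]
   Context: QCTL formulas: $\varphi::= q\mid\neg\varphi\mid\varphi\vee\varphi\mid \mathsf{EX}\varphi\mid \mathsf{E}\varphi\mathsf{U}\varphi\mid\mathsf{A}\varphi\mathsf{U}\varphi\mid\exists p.\varphi$, $\forall p=\neg\exists p\neg$, interpreted at states of finite Kripke structures (every vertex has a successor) with the usual CTL semantics and structure semantics for quantifiers ($\exists p.\varphi$ holds iff some relabelling of $p$ on the same graph, keeping other propositions, makes $\varphi$ true). $\mathsf{EF}\varphi=\mathsf{E}\top\mathsf{U}\varphi$, $\mathsf{AG}\varphi=\neg\mathsf{EF}\neg\varphi$. $\mathrm{uniq}(p)$ abbreviates $\mathsf{E}_{=1}\mathsf{F}\,p=\mathsf{EF}p\wedge\forall q.\big(\mathsf{EF}(q\wedge p)\to\mathsf{AG}(p\to q)\big)$ with $q$ fresh, expressing that exactly one reachable state is labelled by $p$. Equivalence $\equiv$: same truth value at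 every state of every Kripke structure. -}

module Defs where

open import Data.Nat using (ℕ; zero; suc; _<_)
open import Data.Fin using (Fin)
open import Data.Bool using (Bool; true; false)
open import Data.Product using (Σ; ∃; _×_; _,_; proj₁; proj₂)
open import Data.Sum using (_⊎_)
open import Data.List using (List; []; _∷_; _++_; map; foldr)
open import Relation.Nullary using (¬_)
open import Relation.Binary.PropositionalEquality using (_≡_)
open import Data.Nat using (_≟_)
open import Relation.Nullary using (does)

AP : Set
AP = ℕ

data Formula : Set where
  atom : AP → Formula
  neg  : Formula → Formula
  _∨_  : Formula → Formula → Formula
  EX   : Formula → Formula
  EU   : Formula → Formula → Formula
  AU   : Formula → Formula → Formula
  ∃ₚ   : AP → Formula → Formula

_∧_ : Formula → Formula → Formula
φ ∧ ψ = neg (neg φ ∨ neg ψ)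

_⇒_ : Formula → Formula → Formula
φ ⇒ ψ = neg φ ∨ ψ

∀ₚ : AP → Formula → Formula
∀ₚ p φ = neg (∃ₚ p (neg φ))

⊤F : Formula
⊤F = atom 0 ∨ neg (atom 0)

EF : Formula → Formula
EF φ = EU ⊤F φ

AG : Formula → Formula
AG φ = neg (EF (neg φ))

-- uniq(p) = EF p ∧ ∀q.(EF(q ∧ p) → AG(p → q)), with q fresh (q = suc p ≠ p;
-- q is bound locally, so it only needs to differ from p).
uniq : AP → Formula
uniq p = EF (atom p) ∧ ∀ₚ q (EF (atom q ∧ atom p) ⇒ AG (atom p ⇒ atom q))
  where q = suc p

record Kripke : Set where
  field
    n     : ℕ
    R     : Fin n → Fin n → Bool
    total : ∀ s → ∃ λ t → R s t ≡ true
    L     : AP → Fin n → Bool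
open Kripke public

relabel : (K : Kripke) → AP → (Fin (n K) → Bool) → Kripke
relabel K p ℓ = record
  { n = n K ; R = R K ; total = total K
  ; L = λ q s → if′ does (q ≟ p) then ℓ s else L K q s }
  where
  if′_then_else_ : Bool → Bool → Bool → Bool
  if′ true  then a else b = a
  if′ false then a else b = b

_,_⊨_ : (K : Kripke) → Fin (n K) → Formula → Set
K , s ⊨ atom p   = L K p s ≡ true
K , s ⊨ neg φ    = ¬ (K , s ⊨ φ)
K , s ⊨ (φ ∨ ψ)  = (K , s ⊨ φ) ⊎ (K , s ⊨ ψ)
K , s ⊨ EX φ     = Σ (Fin (n K)) λ t → (R K s t ≡ true) × (K , t ⊨ φ)
K , s ⊨ EU φ ψ   =
  Σ (ℕ → Fin (n K)) λ π → Σ ℕ λ k →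
    (π 0 ≡ s) × (∀ i → i < k → R K (π i) (π (suc i)) ≡ true)
    × (K , π k ⊨ ψ) × (∀ i → i < k → K , π i ⊨ φ)
K , s ⊨ AU φ ψ   =
  (π : ℕ → Fin (n K)) → π 0 ≡ s → (∀ i → R K (π i) (π (suc i)) ≡ true) →
    Σ ℕ λ k → (K , π k ⊨ ψ) × (∀ i → i < k → K , π i ⊨ φ)
K , s ⊨ ∃ₚ p φ   = Σ (Fin (n K) → Bool) λ ℓ → relabel K p ℓ , s ⊨ φ

_≡ₛ_ : Formula → Formula → Set
φ ≡ₛ ψ = (K : Kripke) (s : Fin (n K)) →
  ((K , s ⊨ φ) → (K , s ⊨ ψ)) × ((K , s ⊨ ψ) → (K , s ⊨ φ))

data Quant : Set where
  ex all : Quant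

Prefix : Set
Prefix = List (Quant × AP)

quant : Quant × AP → Formula → Formula
quant (ex  , p) φ = ∃ₚ p φ
quant (all , p) φ = ∀ₚ p φ

_·_ : Prefix → Formula → Formula
Q · φ = foldr quant φ Q

boundVars : Prefix → List AP
boundVars = map proj₂

-- Since uniq p₁ and uniq p₂ depend only on p₁ and p₂, relabelling a variable
-- of 𝒬″ does not affect them, so they can be moved into and out of 𝒬″.
-- Under ∀ p₂ the left-hand side therefore holds iff uniq p₁ holds and every
-- instance of 𝒬″.(uniq p₂ → Φ) does.  On the right-hand side, the instance in
-- which p₂ labels exactly the current state satisfies uniq p₂ and so yields
-- uniq p₁, which does not depend on p₂; given uniq p₁ the two matrices agree.
-- The outer prefix 𝒬 ∃p₁ 𝒬′ preserves equivalence.  As ∀ₚ = ¬ ∃ₚ ¬ and the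
-- semantics is constructive, the reasoning takes place in the double-negation
-- monad.
module Submission where

open import Defs
open import Data.Nat using (suc; _≟_; _≡ᵇ_)
open import Data.Nat.Properties using (1+n≢n; ≡ᵇ⇒≡; ≡⇒≡ᵇ)
open import Data.Fin using (Fin)
import Data.Fin.Properties as Fin
open import Data.Bool using (Bool; true; false)
import Data.Bool.Properties as Bool
open import Data.Product using (Σ; _,_; proj₁; proj₂)
open import Data.Empty using (⊥)
open import Data.Sum using (_⊎_; inj₁; inj₂)
open import Data.List using (List; []; _∷_; _++_)
open import Data.List.Properties using (foldr-++; map-++)
open import Data.List.Relation.Unary.All as All using (All; []; _∷_)
import Data.List.Relation.Unary.All.Properties as All
open import Data.List.Relation.Unary.AllPairs using (_∷_)
open import Data.List.Relation.Unary.Unique.Propositional using (Unique)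
open import Effect.Monad using (RawMonad)
open import Level using (0ℓ)
open import Function.Bundles using (_⇔_; mk⇔; Equivalence)
open import Relation.Nullary using (¬_; yes; no; does)
open import Relation.Nullary.Decidable using (dec-true; toSum)
open import Relation.Nullary.Negation using (¬¬-Monad; ¬¬-map; contradiction)
open import Relation.Binary.PropositionalEquality
  using (_≡_; _≢_; refl; sym; trans; subst; subst₂)

open Equivalence using (to; from)
open RawMonad (¬¬-Monad {a = 0ℓ}) using (pure; _>>=_)

relabel-L-≡ : ∀ K r ℓ t → L (relabel K r ℓ) r t ≡ ℓ t
relabel-L-≡ K r ℓ t with r ≡ᵇ r | ≡⇒≡ᵇ r r refl
... | true | _ = refl

relabel-L-≢ : ∀ K r ℓ {q} t → q ≢ r → L (relabel K r ℓ) q t ≡ L K q t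
relabel-L-≢ K r ℓ {q} t q≢r with q ≡ᵇ r | ≡ᵇ⇒≡ q r
... | true  | q≡r = contradiction (q≡r _) q≢r
... | false | _   = refl

-- lem is needed because ⊤F = atom 0 ∨ neg (atom 0) mentions atom 0 although
-- its truth value does not depend on it.
data DependsOnly (P : AP → Set) : Formula → Set where
  atom : ∀ {q} → P q → DependsOnly P (atom q)
  lem  : ∀ q → DependsOnly P (atom q ∨ neg (atom q))
  neg  : ∀ {φ} → DependsOnly P φ → DependsOnly P (neg φ)
  _∨_  : ∀ {φ ψ} → DependsOnly P φ → DependsOnly P ψ → DependsOnly P (φ ∨ ψ)
  EX   : ∀ {φ} → DependsOnly P φ → DependsOnly P (EX φ)
  EU   : ∀ {φ ψ} → DependsOnly P φ → DependsOnly P ψ → DependsOnly P (EU φ ψ)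
  AU   : ∀ {φ ψ} → DependsOnly P φ → DependsOnly P ψ → DependsOnly P (AU φ ψ)
  ∃ₚ   : ∀ r {φ} → DependsOnly (λ q → q ≡ r ⊎ P q) φ → DependsOnly P (∃ₚ r φ)

module _ {P : AP → Set} where

  _∧ᴰ_ : ∀ {φ ψ} → DependsOnly P φ → DependsOnly P ψ → DependsOnly P (φ ∧ ψ)
  dφ ∧ᴰ dψ = neg (neg dφ ∨ neg dψ)

  _⇒ᴰ_ : ∀ {φ ψ} → DependsOnly P φ → DependsOnly P ψ → DependsOnly P (φ ⇒ ψ)
  dφ ⇒ᴰ dψ = neg dφ ∨ dψ

  EFᴰ : ∀ {φ} → DependsOnly P φ → DependsOnly P (EF φ)
  EFᴰ = EU (lem 0)

  AGᴰ : ∀ {φ} → DependsOnly P φ → DependsOnly P (AG φ)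
  AGᴰ dφ = neg (EFᴰ (neg dφ))

  ∀ₚᴰ : ∀ r {φ} → DependsOnly (λ q → q ≡ r ⊎ P q) φ → DependsOnly P (∀ₚ r φ)
  ∀ₚᴰ r dφ = neg (∃ₚ r (neg dφ))

LabelsAgree : (AP → Set) → (K : Kripke) → (AP → Fin (n K) → Bool) → Set
LabelsAgree P K L′ = ∀ q → P q → ∀ t → L K q t ≡ L′ q t

relabel-agree : ∀ {P} K L′ r ℓ → LabelsAgree P K L′ →
  LabelsAgree (λ q → q ≡ r ⊎ P q) (relabel K r ℓ) (L (relabel (record K { L = L′ }) r ℓ))
relabel-agree K L′ r ℓ agree q q∈P t with q ≟ r | q∈P
... | yes refl | _        = trans (relabel-L-≡ K r ℓ t) (sym (relabel-L-≡ K′ r ℓ t))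
  where K′ = record K { L = L′ }
... | no q≢r   | inj₁ q≡r = contradiction q≡r q≢r
... | no q≢r   | inj₂ Pq  =
  trans (relabel-L-≢ K r ℓ t q≢r) (trans (agree q Pq t) (sym (relabel-L-≢ K′ r ℓ t q≢r)))
  where K′ = record K { L = L′ }

-- By η, K = record (record K { L = L′ }) { L = L K } and
-- relabel K r ℓ = record K { L = L (relabel K r ℓ) }; this is what lets frame
-- be applied in the reverse direction and to relabellings.
frame : ∀ {P φ} → DependsOnly P φ → ∀ K L′ → LabelsAgree P K L′ →
  ∀ s → K , s ⊨ φ → record K { L = L′ } , s ⊨ φ
frame (atom {q} Pq) K L′ agree s x = trans (sym (agree q Pq s)) x
frame (lem q) K L′ agree s _ = toSum (L′ q s Bool.≟ true)
frame (neg dφ) K L′ agree s ¬x y =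
  ¬x (frame dφ (record K { L = L′ }) (L K) (λ q Pq t → sym (agree q Pq t)) s y)
frame (dφ ∨ dψ) K L′ agree s (inj₁ x) = inj₁ (frame dφ K L′ agree s x)
frame (dφ ∨ dψ) K L′ agree s (inj₂ y) = inj₂ (frame dψ K L′ agree s y)
frame (EX dφ) K L′ agree s (t , st , x) = t , st , frame dφ K L′ agree t x
frame (EU dφ dψ) K L′ agree s (π , k , π₀ , steps , y , xs) =
  π , k , π₀ , steps , frame dψ K L′ agree (π k) y ,
  λ i i<k → frame dφ K L′ agree (π i) (xs i i<k)
frame (AU dφ dψ) K L′ agree s h π π₀ steps with h π π₀ steps
... | k , y , xs =
  k , frame dψ K L′ agree (π k) y , λ i i<k → frame dφ K L′ agree (π i) (xs i i<k)
frame (∃ₚ r dφ) K L′ agree s (ℓ , x) =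
  ℓ , frame dφ (relabel K r ℓ) _ (relabel-agree K L′ r ℓ agree) s x

Invariant : AP → Formula → Set
Invariant r φ = ∀ K s ℓ → (K , s ⊨ φ) ⇔ (relabel K r ℓ , s ⊨ φ)

invariant : ∀ {P r φ} → DependsOnly P φ → (∀ {q} → P q → q ≢ r) → Invariant r φ
invariant {r = r} dφ P⇒≢r K s ℓ = mk⇔
  (frame dφ K _ (λ q Pq t → sym (relabel-L-≢ K r ℓ t (P⇒≢r Pq))) s)
  (frame dφ (relabel K r ℓ) (L K) (λ q Pq t → relabel-L-≢ K r ℓ t (P⇒≢r Pq)) s)

⊤F-invariant : ∀ r → Invariant r ⊤F
⊤F-invariant r = invariant {P = λ _ → ⊥} {r} (lem 0) (λ ())

⊨⊤F : ∀ K s → K , s ⊨ ⊤F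
⊨⊤F K s = toSum (L K 0 s Bool.≟ true)

uniq-dependsOnly : ∀ p → DependsOnly (_≡ p) (uniq p)
uniq-dependsOnly p =
  EFᴰ (atom refl) ∧ᴰ
  ∀ₚᴰ (suc p) (EFᴰ (atom (inj₁ refl) ∧ᴰ atom (inj₂ refl))
                ⇒ᴰ AGᴰ (atom (inj₂ refl) ⇒ᴰ atom (inj₁ refl)))

uniq-invariant : ∀ {p r} → p ≢ r → Invariant r (uniq p)
uniq-invariant p≢r = invariant (uniq-dependsOnly _) (λ { refl → p≢r })

uniq-intro : ∀ p K s → K , s ⊨ EF (atom p) →
  (∀ {t t′} → L K p t ≡ true → L K p t′ ≡ true → t ≡ t′) → K , s ⊨ uniq p
uniq-intro p K s ef _  (inj₁ ¬ef) = ¬ef ef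
uniq-intro p K s ef p-once (inj₂ ¬all) = ¬all λ (ℓ , ¬body) →
  ¬body (inj₁ λ efqp → ¬body (inj₂ λ efbad → clash ℓ efqp efbad))
  where
  clash : ∀ ℓ → let K′ = relabel K (suc p) ℓ in
    K′ , s ⊨ EF (atom (suc p) ∧ atom p) → K′ , s ⊨ EF (neg (atom p ⇒ atom (suc p))) → ⊥
  clash ℓ (π , k , _ , _ , qp , _) (π′ , k′ , _ , _ , ¬[p⇒q] , _) =
    qp (inj₂ λ pt → qp (inj₁ λ qt → ¬[p⇒q] (inj₁ λ pt′ → ¬[p⇒q] (inj₂
      (subst (λ u → L K′ (suc p) u ≡ true) (p-once (at-p pt) (at-p pt′)) qt)))))
    where
    K′ : Kripke
    K′ = relabel K (suc p) ℓ
    at-p : ∀ {u} → L K′ p u ≡ true → L K p u ≡ true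
    at-p {u} = trans (sym (relabel-L-≢ K (suc p) ℓ u (λ p≡1+p → 1+n≢n (sym p≡1+p))))

only : ∀ {m} → Fin m → Fin m → Bool
only s t = does (t Fin.≟ s)

uniq-only : ∀ p K s → relabel K p (only s) , s ⊨ uniq p
uniq-only p K s = uniq-intro p (relabel K p (only s)) s
  ((λ _ → s) , 0 , refl , (λ _ ()) , p-at-s , λ _ ())
  (λ pt pt′ → trans (p-only pt) (sym (p-only pt′)))
  where
  p-at-s : L (relabel K p (only s)) p s ≡ true
  p-at-s = trans (relabel-L-≡ K p (only s) s) (dec-true (s Fin.≟ s) refl)
  p-only : ∀ {t} → L (relabel K p (only s)) p t ≡ true → t ≡ s
  p-only {t} e with t Fin.≟ s | trans (sym (relabel-L-≡ K p (only s) t)) e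
  ... | yes t≡s | _ = t≡s
  ... | no _    | ()

∀ₚ-intro : ∀ {K s} r φ → (∀ ℓ → ¬ ¬ (relabel K r ℓ , s ⊨ φ)) → K , s ⊨ ∀ₚ r φ
∀ₚ-intro r φ f (ℓ , ¬x) = f ℓ ¬x

∀ₚ-elim : ∀ {K s} r φ → K , s ⊨ ∀ₚ r φ → ∀ ℓ → ¬ ¬ (relabel K r ℓ , s ⊨ φ)
∀ₚ-elim r φ h ℓ ¬x = h (ℓ , ¬x)

infix 4 _⊢_⇛_

_⊢_⇛_ : Formula → Formula → Formula → Set
C ⊢ φ ⇛ ψ = ∀ K s → K , s ⊨ C → K , s ⊨ φ → ¬ ¬ (K , s ⊨ ψ)

InvariantUnder : Prefix → Formula → Set
InvariantUnder Q φ = All (λ r → Invariant r φ) (boundVars Q)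

·-mono : ∀ Q {C φ ψ} → InvariantUnder Q C → C ⊢ φ ⇛ ψ → C ⊢ Q · φ ⇛ Q · ψ
·-mono [] _ φ⇛ψ = φ⇛ψ
·-mono ((ex , r) ∷ Q) (inv ∷ invs) φ⇛ψ K s c (ℓ , x) =
  ¬¬-map (ℓ ,_) (·-mono Q invs φ⇛ψ (relabel K r ℓ) s (to (inv K s ℓ) c) x)
·-mono ((all , r) ∷ Q) {φ = φ} {ψ} (inv ∷ invs) φ⇛ψ K s c h =
  pure (∀ₚ-intro r (Q · ψ) λ ℓ → do
    x ← ∀ₚ-elim r (Q · φ) h ℓ
    ·-mono Q invs φ⇛ψ (relabel K r ℓ) s (to (inv K s ℓ) c) x)

·-elim : ∀ Q {A} → InvariantUnder Q A → ∀ K s → K , s ⊨ (Q · A) → ¬ ¬ (K , s ⊨ A)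
·-elim [] _ K s = pure
·-elim ((ex , r) ∷ Q) (inv ∷ invs) K s (ℓ , x) =
  ¬¬-map (from (inv K s ℓ)) (·-elim Q invs (relabel K r ℓ) s x)
·-elim ((all , r) ∷ Q) {A} (inv ∷ invs) K s h = do
  x ← ∀ₚ-elim r (Q · A) h (L K r)
  a ← ·-elim Q invs (relabel K r (L K r)) s x
  pure (from (inv K s (L K r)) a)

·-extract : ∀ Q {C φ A} → InvariantUnder Q C → InvariantUnder Q A →
  C ⊢ φ ⇛ A → C ⊢ Q · φ ⇛ A
·-extract Q invC invA φ⇛A K s c x =
  ·-mono Q invC φ⇛A K s c x >>= ·-elim Q invA K s

∀ₚ-swap-guards : ∀ p Q {U₁ U₂ Φ} → Invariant p U₁ →
  InvariantUnder Q U₁ → InvariantUnder Q U₂ →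
  (∀ K s → Σ (Fin (n K) → Bool) λ ℓ → relabel K p ℓ , s ⊨ U₂) →
  ∀ₚ p (Q · (U₁ ∧ (U₂ ⇒ Φ))) ≡ₛ ∀ₚ p (Q · (U₂ ⇒ (U₁ ∧ Φ)))
∀ₚ-swap-guards p Q {U₁} {U₂} {Φ} inv₁ invQ₁ invQ₂ enforce K s = lhs⇒rhs , rhs⇒lhs
  where
  X Y : Formula
  X = U₁ ∧ (U₂ ⇒ Φ)
  Y = U₂ ⇒ (U₁ ∧ Φ)

  X⇛U₁ : ⊤F ⊢ X ⇛ U₁
  X⇛U₁ _ _ _ x ¬u₁ = x (inj₁ ¬u₁)

  X⇛Y : U₁ ⊢ X ⇛ Y
  X⇛Y _ _ u₁ x ¬y = x (inj₂ λ
    { (inj₁ ¬u₂) → ¬y (inj₁ ¬u₂)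
    ; (inj₂ φ)   → ¬y (inj₂ λ { (inj₁ ¬u₁) → ¬u₁ u₁ ; (inj₂ ¬φ) → ¬φ φ }) })

  Y⇛U₁ : U₂ ⊢ Y ⇛ U₁
  Y⇛U₁ _ _ u₂ (inj₁ ¬u₂)   = contradiction u₂ ¬u₂
  Y⇛U₁ _ _ u₂ (inj₂ u₁∧φ) ¬u₁ = u₁∧φ (inj₁ ¬u₁)

  Y⇛X : U₁ ⊢ Y ⇛ X
  Y⇛X K′ s′ u₁ y ¬x = ¬x λ
    { (inj₁ ¬u₁)     → ¬u₁ u₁
    ; (inj₂ ¬[u₂⇒φ]) → case y ¬[u₂⇒φ] }
    where
    case : K′ , s′ ⊨ Y → K′ , s′ ⊨ neg (U₂ ⇒ Φ) → ⊥
    case (inj₁ ¬u₂) ¬[u₂⇒φ] = ¬[u₂⇒φ] (inj₁ ¬u₂)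
    case (inj₂ u₁∧φ) ¬[u₂⇒φ] = u₁∧φ (inj₂ λ φ → ¬[u₂⇒φ] (inj₂ φ))

  lhs⇒rhs : K , s ⊨ ∀ₚ p (Q · X) → K , s ⊨ ∀ₚ p (Q · Y)
  lhs⇒rhs h = ∀ₚ-intro p (Q · Y) λ ℓ → do
    x  ← ∀ₚ-elim p (Q · X) h ℓ
    u₁ ← ·-extract Q {C = ⊤F} (All.universal ⊤F-invariant _) invQ₁ X⇛U₁
           (relabel K p ℓ) s (⊨⊤F (relabel K p ℓ) s) x
    ·-mono Q invQ₁ X⇛Y (relabel K p ℓ) s u₁ x

  rhs⇒lhs : K , s ⊨ ∀ₚ p (Q · Y) → K , s ⊨ ∀ₚ p (Q · X)
  rhs⇒lhs h = ∀ₚ-intro p (Q · X) λ ℓ → do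
    let (ℓ₂ , u₂) = enforce K s
    y₂ ← ∀ₚ-elim p (Q · Y) h ℓ₂
    u₁ ← ·-extract Q invQ₂ invQ₁ Y⇛U₁ (relabel K p ℓ₂) s u₂ y₂
    y  ← ∀ₚ-elim p (Q · Y) h ℓ
    ·-mono Q invQ₁ Y⇛X (relabel K p ℓ) s (to (inv₁ K s ℓ) (from (inv₁ K s ℓ₂) u₁)) y

neg-cong : ∀ {φ ψ} → φ ≡ₛ ψ → neg φ ≡ₛ neg ψ
neg-cong φ≡ψ K s = (λ ¬x y → ¬x (proj₂ (φ≡ψ K s) y)) , (λ ¬y x → ¬y (proj₁ (φ≡ψ K s) x))

∃ₚ-cong : ∀ r {φ ψ} → φ ≡ₛ ψ → ∃ₚ r φ ≡ₛ ∃ₚ r ψ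
∃ₚ-cong r φ≡ψ K s =
  (λ (ℓ , x) → ℓ , proj₁ (φ≡ψ (relabel K r ℓ) s) x) ,
  (λ (ℓ , y) → ℓ , proj₂ (φ≡ψ (relabel K r ℓ) s) y)

·-cong : ∀ Q {φ ψ} → φ ≡ₛ ψ → (Q · φ) ≡ₛ (Q · ψ)
·-cong [] φ≡ψ = φ≡ψ
·-cong ((ex , r) ∷ Q) φ≡ψ = ∃ₚ-cong r (·-cong Q φ≡ψ)
·-cong ((all , r) ∷ Q) {φ} {ψ} φ≡ψ =
  neg-cong {∃ₚ r (neg (Q · φ))} {∃ₚ r (neg (Q · ψ))}
    (∃ₚ-cong r {neg (Q · φ)} {neg (Q · ψ)} (neg-cong (·-cong Q φ≡ψ)))

++-·-cong : ∀ Q Q′ {φ ψ} → (Q′ · φ) ≡ₛ (Q′ · ψ) → ((Q ++ Q′) · φ) ≡ₛ ((Q ++ Q′) · ψ)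
++-·-cong Q Q′ {φ} {ψ} e =
  subst₂ _≡ₛ_ (sym (foldr-++ quant φ Q Q′)) (sym (foldr-++ quant ψ Q Q′)) (·-cong Q e)

boundVars-++ : ∀ Q Q′ → boundVars (Q ++ Q′) ≡ boundVars Q ++ boundVars Q′
boundVars-++ Q Q′ = map-++ proj₂ Q Q′

Unique-++⁻ʳ : ∀ (xs : List AP) {ys} → Unique (xs ++ ys) → Unique ys
Unique-++⁻ʳ []       u       = u
Unique-++⁻ʳ (_ ∷ xs) (_ ∷ u) = Unique-++⁻ʳ xs u

proposition8 : (Q Q′ Q″ : Prefix) (p₁ p₂ : AP) (Φ : Formula) →
    Unique (boundVars (Q ++ (ex , p₁) ∷ Q′ ++ (all , p₂) ∷ Q″)) →
    ((Q ++ (ex , p₁) ∷ Q′ ++ (all , p₂) ∷ Q″) · (uniq p₁ ∧ (uniq p₂ ⇒ Φ)))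
      ≡ₛ ((Q ++ (ex , p₁) ∷ Q′ ++ (all , p₂) ∷ Q″) · (uniq p₂ ⇒ (uniq p₁ ∧ Φ)))
proposition8 Q Q′ Q″ p₁ p₂ Φ u
  with p₁∉ ∷ u′ ← Unique-++⁻ʳ (boundVars Q) (subst Unique (boundVars-++ Q _) u)
  with p₁≢p₂ ∷ p₁∉Q″ ← All.++⁻ʳ (boundVars Q′) (subst (All (p₁ ≢_)) (boundVars-++ Q′ _) p₁∉)
  with p₂∉Q″ ∷ _ ← Unique-++⁻ʳ (boundVars Q′) (subst Unique (boundVars-++ Q′ _) u′) =
  ++-·-cong Q _ (·-cong ((ex , p₁) ∷ []) (++-·-cong Q′ _
    (∀ₚ-swap-guards p₂ Q″ (uniq-invariant p₁≢p₂)
      (All.map uniq-invariant p₁∉Q″) (All.map uniq-invariant p₂∉Q″)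
      (λ K s → only s , uniq-only p₂ K s))))
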